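{- Let $C=R(x,y,\vec z)$ be a constraint over a finite domain $D$ (with $x,y\notin\tilde z$, $x\neq y$) such that there are two solutions $a,b$ of $C$ with the property that for every partition $(\tilde z_1,\tilde z_2)$ of $\tilde z$ we have $a|_{\{x\}\cup\tilde z_1}\cup b|_{\{y\}\cup\tilde z_2}\notin\mathrm{sol}(C)$ or $a|_{\{y\}\cup\tilde z_2}\cup b|_{\{x\}\cup\tilde z_1}\notin\mathrm{sol}(C)$. Let $F_n:=\bigwedge_{i\in[n]}R(x_i,y_i,\vec z_i)$, where the tuples $(x_i,y_i,\vec z_i)$ use pairwise disjoint sets of variables. Let $(\tilde x,\tilde y)$ be a partition of the variables of $F_n$ and let $\mathcal R$ be a rectangle cover of $F_n$ such that every rectangle in $\mathcal R$ is a rectangle w.r.t. $(\tilde x,\tilde y)$. If for every $i\in[n]$ either $x_i\in\tilde x$ and $y_i\in\tilde y$, or $x_i\in\tilde y$ and $y_i\in\tilde x$, then $|\mathcal R|\ge 2^n$.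
   Context: A constraint $R(x_1,\dots,x_k)$ with $R\subseteq D^k$ has scope $\tilde u$ and solution set $\mathrm{sol}$ consisting of the maps $\beta:\tilde u\to D$ with $(\beta(x_1),\dots,\beta(x_k))\in R$; a conjunction of constraints has the union of scopes and as solutions the maps whose restrictions solve every conjunct. $\pi_Y$ restricts solutions to $Y$. A constraint $\mathfrak r$ with scope $\tilde x\cup\tilde y$ ($\tilde x\cap\tilde y=\emptyset$) is a rectangle w.r.t. $(\tilde x,\tilde y)$ if $\mathfrak r=\pi_{\tilde x}\mathfrak r\times\pi_{\tilde y}\mathfrak r$ (Cartesian product of assignments). A rectangle cover of a constraint $F$ is a set $\mathcal R$ of rectangles with the same scope as $F$ such that $\mathrm{sol}(F)=\bigcup_{\mathfrak r\in\mathcal R}\mathrm{sol}(\mathfrak r)$. -}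

module Defs where

open import Data.Nat using (ℕ)
open import Data.Fin using (Fin)
open import Data.Bool using (Bool; true; false; if_then_else_)
open import Data.Product using (Σ; _×_; ∃-syntax)
open import Relation.Binary.PropositionalEquality using (_≡_)

-- A constraint C = R(x, y, z⃗) is represented by its solution set: a predicate on
-- triples (value of x, value of y, values of the m distinct variables of z̃).
-- x ≠ y and x, y ∉ z̃ are built into this representation.
Rel3 : ℕ → ℕ → Set₁
Rel3 d m = Fin d → Fin d → (Fin m → Fin d) → Set

data Pos (m : ℕ) : Set where
  px : Pos m
  py : Pos m
  pz : Fin m → Pos m

-- Variables of F_n: copy index i ∈ [n] and a position; copies are pairwise disjoint.
Var : ℕ → ℕ → Set
Var n m = Fin n × Pos m

Assign : ℕ → ℕ → ℕ → Set
Assign d n m = Var n m → Fin d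

SolF : ∀ {d m} → Rel3 d m → (n : ℕ) → Assign d n m → Set
SolF R n β = ∀ (i : Fin n) → R (β (i Data.Product., px)) (β (i Data.Product., py))
                                (λ j → β (i Data.Product., pz j))

Constraint : ℕ → ℕ → ℕ → Set₁
Constraint d n m = Assign d n m → Set

-- A partition (x̃, ỹ) of the variables: side v ≡ true means v ∈ x̃, false means v ∈ ỹ.
Side : ℕ → ℕ → Set
Side n m = Var n m → Bool

AgreeOn : ∀ {d n m} → Side n m → Bool → Assign d n m → Assign d n m → Set
AgreeOn side s β γ = ∀ v → side v ≡ s → β v ≡ γ v

-- 𝔯 is a rectangle w.r.t. (x̃, ỹ):  sol(𝔯) = π_x̃ 𝔯 × π_ỹ 𝔯, i.e. an assignment is a
-- solution iff its restriction to x̃ is the restriction of some solution and its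
-- restriction to ỹ is the restriction of some solution.
IsRectangle : ∀ {d n m} → Side n m → Constraint d n m → Set
IsRectangle {d} {n} {m} side r =
  ∀ (β : Assign d n m) →
    (r β → (∃[ γ ] (r γ × AgreeOn side true β γ)) × (∃[ δ ] (r δ × AgreeOn side false β δ)))
  × ((∃[ γ ] (r γ × AgreeOn side true β γ)) × (∃[ δ ] (r δ × AgreeOn side false β δ)) → r β)

IsRectCover : ∀ {d m} → Rel3 d m → (n : ℕ) → Side n m → (k : ℕ) →
              (Fin k → Constraint d n m) → Set
IsRectCover {d} {m} R n side k 𝓡 =
  (∀ t → IsRectangle side (𝓡 t))
  × (∀ (β : Assign d n m) → (SolF R n β → ∃[ t ] 𝓡 t β) × (∃[ t ] 𝓡 t β → SolF R n β))

-- The combination of a on {x} ∪ z̃₁ with b on {y} ∪ z̃₂, where z̃₁ = {j | p j ≡ true}.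
merge₁ : ∀ {d m} → (Fin m → Bool) → (Fin d × Fin d × (Fin m → Fin d)) →
         (Fin d × Fin d × (Fin m → Fin d)) → Fin d × Fin d × (Fin m → Fin d)
merge₁ p (ax Data.Product., ay Data.Product., az) (bx Data.Product., by Data.Product., bz) =
  ax Data.Product., by Data.Product., (λ j → if p j then az j else bz j)

merge₂ : ∀ {d m} → (Fin m → Bool) → (Fin d × Fin d × (Fin m → Fin d)) →
         (Fin d × Fin d × (Fin m → Fin d)) → Fin d × Fin d × (Fin m → Fin d)
merge₂ p (ax Data.Product., ay Data.Product., az) (bx Data.Product., by Data.Product., bz) =
  bx Data.Product., ay Data.Product., (λ j → if p j then bz j else az j)

Holds : ∀ {d m} → Rel3 d m → Fin d × Fin d × (Fin m → Fin d) → Set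
Holds R (vx Data.Product., vy Data.Product., vz) = R vx vy vz

{-# OPTIONS --safe #-}
module Submission where

open import Defs
open import Function using (_∘_)
open import Data.Nat using (ℕ; zero; suc; _≤_; _^_)
open import Data.Fin using (Fin; zero; suc; finToFun; funToFin; combine)
open import Data.Fin.Properties using (injective⇒≤; funToFin-finToFin; _≟_)
open import Data.Bool using (Bool; true; false; if_then_else_; not)
open import Data.Bool.Properties using (not-injective)
open import Data.Product using (_×_; _,_; proj₁; proj₂; ∃-syntax)
open import Data.Sum using (_⊎_; inj₁; inj₂)
open import Relation.Nullary using (¬_)
open import Relation.Nullary.Decidable using (decidable-stable)
open import Relation.Binary.PropositionalEquality
  using (_≡_; _≢_; _≗_; refl; sym; cong; cong₂; subst; module ≡-Reasoning)

-- Give every copy of C the solution a or b, as prescribed by a choice vector S ∈ {a,b}ⁿ.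
-- Two different choice vectors cannot share a rectangle: at a copy i where they differ,
-- the rectangle also contains the two assignments obtained by exchanging their x̃-parts,
-- and on copy i these are exactly the two combinations of a and b that the hypothesis
-- forbids from being solutions simultaneously. So the 2ⁿ choice vectors need 2ⁿ rectangles.

private
  variable
    d k m n : ℕ

Triple : ℕ → ℕ → Set
Triple d m = Fin d × Fin d × (Fin m → Fin d)

entries : Triple d m → Pos m → Fin d
entries (x , y , z) px     = x
entries (x , y , z) py     = y
entries (x , y , z) (pz j) = z j

fromEntries : (Pos m → Fin d) → Triple d m
fromEntries e = e px , e py , λ j → e (pz j)

mix : {A B : Set} → (A → Bool) → (A → B) → (A → B) → A → B
mix g f h v = if g v then f v else h v

mixTriple : (Pos m → Bool) → Triple d m → Triple d m → Triple d m
mixTriple s u w = fromEntries (mix s (entries u) (entries w))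

Unmixable : Rel3 d m → Triple d m → Triple d m → Set
Unmixable {m = m} R a b = ∀ (p : Fin m → Bool) → ¬ Holds R (merge₁ p a b) ⊎ ¬ Holds R (merge₂ p a b)

SeparatesEachCopy : Side n m → Set
SeparatesEachCopy {n} side = ∀ (i : Fin n) → (side (i , px) ≡ true × side (i , py) ≡ false)
                                           ⊎ (side (i , px) ≡ false × side (i , py) ≡ true)

funToFin-cong : {f h : Fin n → Fin m} → f ≗ h → funToFin f ≡ funToFin h
funToFin-cong {zero}  eq = refl
funToFin-cong {suc n} eq = cong₂ combine (eq zero) (funToFin-cong (eq ∘ suc))

finToFun-injective : {u v : Fin (m ^ n)} → finToFun {m} {n} u ≗ finToFun v → u ≡ v
finToFun-injective {m} {n} {u} {v} eq = begin
  u                             ≡⟨ sym (funToFin-finToFin {n} {m} u) ⟩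
  funToFin (finToFun {m} {n} u) ≡⟨ funToFin-cong eq ⟩
  funToFin (finToFun {m} {n} v) ≡⟨ funToFin-finToFin {n} {m} v ⟩
  v                             ∎
  where open ≡-Reasoning

^≤-if-≗-injective : (f : (Fin n → Fin m) → Fin k) →
                    (∀ {S T} → f S ≡ f T → S ≗ T) → m ^ n ≤ k
^≤-if-≗-injective {n} {m} f inj =
  injective⇒≤ {f = f ∘ finToFun} (λ eq → finToFun-injective {m} {n} (inj eq))

mix-closed : {side : Side n m} {r : Constraint d n m} {β γ : Assign d n m} →
             IsRectangle side r → r β → r γ → r (mix side β γ)
mix-closed {β = β} {γ} rect rβ rγ = proj₂ (rect _)
  ( (β , rβ , λ v eq → cong (λ c → if c then β v else γ v) eq)
  , (γ , rγ , λ v eq → cong (λ c → if c then β v else γ v) eq) )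

rectangle-flip : {side : Side n m} {r : Constraint d n m} →
                 IsRectangle side r → IsRectangle (not ∘ side) r
rectangle-flip {side = side} {r} rect β =
    (λ rβ → let (left , right) = proj₁ (rect β) rβ in flip right , flip left)
  , λ (left , right) → proj₂ (rect β) (unflip right , unflip left)
  where
  flip : ∀ {s} → ∃[ δ ] (r δ × AgreeOn side s β δ) → ∃[ δ ] (r δ × AgreeOn (not ∘ side) (not s) β δ)
  flip (δ , rδ , agree) = δ , rδ , λ v eq → agree v (not-injective eq)
  unflip : ∀ {s} → ∃[ δ ] (r δ × AgreeOn (not ∘ side) (not s) β δ) → ∃[ δ ] (r δ × AgreeOn side s β δ)
  unflip (δ , rδ , agree) = δ , rδ , λ v eq → agree v (cong not eq)

cover-sound : {R : Rel3 d m} {side : Side n m} {𝓡 : Fin k → Constraint d n m} →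
              IsRectCover R n side k 𝓡 → ∀ t {β} → 𝓡 t β → SolF R n β
cover-sound (_ , covers) t rβ = proj₂ (covers _) (t , rβ)

pick : Triple d m → Triple d m → Fin 2 → Triple d m
pick a b zero       = a
pick a b (suc zero) = b

choice : Triple d m → Triple d m → (Fin n → Fin 2) → Assign d n m
choice a b S (i , p) = entries (pick a b (S i)) p

module _ (R : Rel3 d m) (a b : Triple d m) where

  pick-holds : Holds R a → Holds R b → ∀ c → Holds R (pick a b c)
  pick-holds ha hb zero       = ha
  pick-holds ha hb (suc zero) = hb

  choice-solves : Holds R a → Holds R b → ∀ S → SolF R n (choice a b S)
  choice-solves ha hb S i = pick-holds ha hb (S i)

  module _ (unmixable : Unmixable R a b) (s : Pos m → Bool) (sx : s px ≡ true) (sy : s py ≡ false) where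

    -- With s px and s py fixed, mixTriple s a b is merge₁ (s ∘ pz) a b and
    -- mixTriple s b a is merge₂ (s ∘ pz) a b.
    unmixable-exchange : Holds R (mixTriple s a b) → ¬ Holds R (mixTriple s b a)
    unmixable-exchange hab hba with unmixable (s ∘ pz)
    ... | inj₁ ¬merge₁ rewrite sx | sy = ¬merge₁ hab
    ... | inj₂ ¬merge₂ rewrite sx | sy = ¬merge₂ hba

    pick-exchange : ∀ {c c'} → c ≢ c' → Holds R (mixTriple s (pick a b c) (pick a b c')) →
                    ¬ Holds R (mixTriple s (pick a b c') (pick a b c))
    pick-exchange {zero}     {zero}     c≢c' _   _   = c≢c' refl
    pick-exchange {zero}     {suc zero} _    hab hba = unmixable-exchange hab hba
    pick-exchange {suc zero} {zero}     _    hba hab = unmixable-exchange hab hba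
    pick-exchange {suc zero} {suc zero} c≢c' _   _   = c≢c' refl

  choices-agree : {side : Side n m} {r : Constraint d n m} →
                  Unmixable R a b → IsRectangle side r → (∀ {β} → r β → SolF R n β) →
                  ∀ {S T} → r (choice a b S) → r (choice a b T) →
                  ∀ i → side (i , px) ≡ true → side (i , py) ≡ false → S i ≡ T i
  -- Copy i of mix side (choice a b S) (choice a b T) is definitionally
  -- mixTriple (λ p → side (i , p)) (pick a b (S i)) (pick a b (T i)).
  choices-agree {side = side} unmixable rect sound {S} {T} rS rT i sx sy =
    decidable-stable (S i ≟ T i) λ Sᵢ≢Tᵢ →
      pick-exchange unmixable (λ p → side (i , p)) sx sy Sᵢ≢Tᵢ
        (sound (mix-closed rect rS rT) i) (sound (mix-closed rect rT rS) i)

  same-rectangle⇒same-choice : {side : Side n m} {r : Constraint d n m} →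
    Unmixable R a b → SeparatesEachCopy side → IsRectangle side r → (∀ {β} → r β → SolF R n β) →
    ∀ {S T} → r (choice a b S) → r (choice a b T) → S ≗ T
  same-rectangle⇒same-choice unmixable separates rect sound rS rT i with separates i
  ... | inj₁ (sx , sy) = choices-agree unmixable rect sound rS rT i sx sy
  ... | inj₂ (sx , sy) =
    -- x_i ∈ ỹ: pass to the complementary partition rather than negating the selector
    -- pointwise, which would require function extensionality inside R.
    choices-agree unmixable (rectangle-flip rect) sound rS rT i (cong not sx) (cong not sy)

lemma33 : (d m : ℕ) (R : Rel3 d m)
    (a b : Fin d × Fin d × (Fin m → Fin d)) →
    Holds R a → Holds R b →
    (∀ (p : Fin m → Bool) → ¬ Holds R (merge₁ p a b) ⊎ ¬ Holds R (merge₂ p a b)) →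
    (n : ℕ) (side : Side n m) →
    (∀ (i : Fin n) → (side (i Data.Product., px) ≡ true × side (i Data.Product., py) ≡ false)
                   ⊎ (side (i Data.Product., px) ≡ false × side (i Data.Product., py) ≡ true)) →
    (k : ℕ) (𝓡 : Fin k → Constraint d n m) →
    IsRectCover R n side k 𝓡 →
    2 ^ n ≤ k
lemma33 d m R a b ha hb unmixable n side separates k 𝓡 cover@(rectangles , covers) =
  ^≤-if-≗-injective rectangleOf same-rectangle
  where
  covered : ∀ S → ∃[ t ] 𝓡 t (choice a b S)
  covered S = proj₁ (covers (choice a b S)) (choice-solves R a b ha hb S)

  rectangleOf : (Fin n → Fin 2) → Fin k
  rectangleOf S = proj₁ (covered S)

  same-rectangle : ∀ {S T} → rectangleOf S ≡ rectangleOf T → S ≗ T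
  same-rectangle {S} {T} eq =
    same-rectangle⇒same-choice R a b unmixable separates
      (rectangles (rectangleOf S)) (cover-sound {R = R} cover (rectangleOf S))
      (proj₂ (covered S)) (subst (λ t → 𝓡 t (choice a b T)) (sym eq) (proj₂ (covered T)))
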